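{- Let $\lambda\neq0$ be real. For all integers $n,k\ge 0$, $$\sum_{j=0}^{n}S_{2,\lambda}^{[2]}(n-j+k,2k)\binom{n+k}{j}\beta_{j,\lambda}=(-1)^{k}\binom{n+k}{k}\beta_{n,\lambda}+(n+k)!\sum_{j=1}^{k}\frac{(-1)^{k-j}}{j\,(k-j)!\,(n+j-1)!}S_{2,\lambda}(n+j-1,j-1).$$
   Context: For real $x$ and nonzero real $\lambda$, $(x)_{0,\lambda}=1$ and $(x)_{n,\lambda}=x(x-\lambda)\cdots(x-(n-1)\lambda)$ for $n\ge1$; $e_\lambda(t)=(1+\lambda t)^{1/\lambda}=\sum_{k\ge0}(1)_{k,\lambda}\frac{t^k}{k!}$. The degenerate Stirling numbers of the second kind are defined by $\frac{1}{k!}(e_\lambda(t)-1)^k=\sum_{n\ge k}S_{2,\lambda}(n,k)\frac{t^n}{n!}$. The $2$-truncated degenerate Stirling numbers of the second kind are defined by $\frac{1}{k!}(e_\lambda(t)-1-t)^k=\sum_{n\ge 2k}S_{2,\lambda}^{[2]}(n,2k)\frac{t^n}{n!}$, with $S_{2,\lambda}^{[2]}(n,2k)=0$ for $0\le n<2k$. The degenerate Bernoulli numbers $\beta_{n,\lambda}$ are defined by $\frac{t}{e_\lambda(t)-1}=\sum_{n\ge0}\beta_{n,\lambda}\frac{t^n}{n!}$. -}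

module Defs where

open import Level using (Level; _⊔_) renaming (suc to lsuc)
open import Data.Nat as ℕ using (ℕ; zero; suc)
open import Data.Nat.Combinatorics using (_C_)
open import Relation.Nullary using (¬_)
open import Algebra.Bundles using (CommutativeRing)

ιR : ∀ {c ℓ} (R : CommutativeRing c ℓ) → ℕ → CommutativeRing.Carrier R
ιR R zero    = CommutativeRing.0# R
ιR R (suc n) = CommutativeRing._+_ R (CommutativeRing.1# R) (ιR R n)

-- A field of characteristic zero (ℝ is an instance).  The inverse is a total
-- function, only specified on nonzero elements.
record Char0Field (c ℓ : Level) : Set (lsuc (c ⊔ ℓ)) where
  field
    commutativeRing : CommutativeRing c ℓ
  open CommutativeRing commutativeRing public
  ι : ℕ → Carrier
  ι = ιR commutativeRing
  field
    _⁻¹      : Carrier → Carrier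
    inverseʳ : ∀ x → ¬ (x ≈ 0#) → x * (x ⁻¹) ≈ 1#
    charZero : ∀ n → ¬ (ι (suc n) ≈ 0#)

module WithField {c ℓ : Level} (F : Char0Field c ℓ) where
  open Char0Field F public

  fact : ℕ → ℕ
  fact zero    = 1
  fact (suc n) = suc n ℕ.* fact n

  pow : Carrier → ℕ → Carrier
  pow x zero    = 1#
  pow x (suc n) = x * pow x n

  ∑ : ℕ → (ℕ → Carrier) → Carrier
  ∑ zero    f = 0#
  ∑ (suc m) f = ∑ m f + f m

  fall : Carrier → ℕ → Carrier → Carrier
  fall x zero    λ′ = 1#
  fall x (suc n) λ′ = fall x n λ′ * (x - ι n * λ′)

  -- formal power series in t, given by their coefficient sequences
  Series : Set c
  Series = ℕ → Carrier

  _·ₛ_ : Series → Series → Series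
  (f ·ₛ g) n = ∑ (suc n) (λ i → f i * g (n ℕ.∸ i))

  oneₛ : Series
  oneₛ zero    = 1#
  oneₛ (suc n) = 0#

  tₛ : Series
  tₛ (suc zero) = 1#
  tₛ _          = 0#

  _^ₛ_ : Series → ℕ → Series
  f ^ₛ zero  = oneₛ
  f ^ₛ suc k = f ·ₛ (f ^ₛ k)

  eλ : Carrier → Series
  eλ λ′ k = fall 1# k λ′ * (ι (fact k) ⁻¹)

  eλ-1 : Carrier → Series
  eλ-1 λ′ zero    = 0#
  eλ-1 λ′ (suc k) = eλ λ′ (suc k)

  eλ-1-t : Carrier → Series
  eλ-1-t λ′ n = eλ-1 λ′ n - tₛ n

  -- degenerate Stirling numbers of the second kind:
  -- (1/k!) (e_λ(t)-1)^k = Σ_n S_{2,λ}(n,k) t^n/n!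
  S2 : Carrier → ℕ → ℕ → Carrier
  S2 λ′ n k = ι (fact n) * ((ι (fact k) ⁻¹) * ((eλ-1 λ′ ^ₛ k) n))

  -- 2-truncated: S2tr λ n k  stands for  S^{[2]}_{2,λ}(n, 2k), where
  -- (1/k!) (e_λ(t)-1-t)^k = Σ_n S^{[2]}_{2,λ}(n,2k) t^n/n!
  S2tr : Carrier → ℕ → ℕ → Carrier
  S2tr λ′ n k = ι (fact n) * ((ι (fact k) ⁻¹) * ((eλ-1-t λ′ ^ₛ k) n))

  -- β is the sequence of degenerate Bernoulli numbers:
  -- (Σ_n β_n t^n/n!) · (e_λ(t) - 1) = t   (equivalent to t/(e_λ(t)-1) = Σ β_n t^n/n!)
  IsDegBernoulli : Carrier → (ℕ → Carrier) → Set ℓ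
  IsDegBernoulli λ′ β =
    ∀ n → ((λ m → β m * (ι (fact m) ⁻¹)) ·ₛ eλ-1 λ′) n ≈ tₛ n

  binom : ℕ → ℕ → Carrier
  binom n j = ι (n C j)

-- Put b(t) = Σ β_m t^m/m! and u(t) = e_λ(t) - 1, so that b u = t.  Up to the
-- factor (n+k)!/k!, the left-hand side is the coefficient of t^(n+k) in
-- b (u - t)^k, since (u - t)^k has no terms of degree below k.  Expanding
-- (u - t)^k binomially, the term u^0 contributes (-1)^k b_n, and for i ≥ 1 the
-- identity b u^i = t u^(i-1) turns the term into a coefficient of u^(i-1),
-- i.e. into S_{2,λ}(n+i-1, i-1).

module Submission where

open import Defs
open import Level using (Level)
open import Data.Nat as ℕ using (ℕ; zero; suc; _∸_; _≤_; _<_; z≤n; s≤s; _!)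
import Data.Nat.Properties as ℕₚ
open import Data.Nat.Combinatorics using (_C_; k![n∸k]!∣n!)
open import Data.Nat.Combinatorics.Specification using (nCk≡n!/k![n-k]!)
open import Data.Nat.DivMod using (m/n*n≡m)
open import Data.Fin using (toℕ)
open import Data.Product using (_,_)
open import Relation.Nullary using (¬_)
open import Relation.Binary.PropositionalEquality as ≡ using (_≡_)
open import Algebra.Bundles using (CommutativeRing)
import Algebra.Solver.Ring.NaturalCoefficients.Default as NaturalCoefficientsSolver
import Algebra.Properties.CommutativeSemigroup as CommutativeSemigroupProperties
import Algebra.Properties.Ring as RingProperties
import Algebra.Properties.Semiring.Mult as SemiringMult
import Algebra.Properties.Semiring.Sum as SemiringSum
import Algebra.Properties.Semiring.Exp as SemiringExp
import Algebra.Properties.CommutativeSemiring.Binomial as Binomial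

binom*fact*fact≡fact : ∀ {m j} → j ≤ m → (m C j) ℕ.* (j ! ℕ.* (m ∸ j) !) ≡ m !
binom*fact*fact≡fact {m} {j} j≤m = ≡.trans
  (≡.cong (ℕ._* (j ! ℕ.* (m ∸ j) !)) (nCk≡n!/k![n-k]! j≤m))
  (m/n*n≡m {{j !* (m ∸ j) !≢0}} (k![n∸k]!∣n! j≤m))
  where open ℕₚ using (_!*_!≢0)

module _ {c ℓ : Level} (F : Char0Field c ℓ) where
  open WithField F
  open import Relation.Binary.Reasoning.Setoid setoid
  open NaturalCoefficientsSolver commutativeSemiring using (solve; _:=_; _:+_; _:*_)
  open CommutativeSemigroupProperties +-commutativeSemigroup using (interchange)
  open RingProperties ring using (-1*x≈-x)
  open SemiringMult semiring using (_×_; ×1-homo-*)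

  ∑-cong-< : ∀ m {f g : ℕ → Carrier} → (∀ i → i < m → f i ≈ g i) → ∑ m f ≈ ∑ m g
  ∑-cong-< zero    f≈g = refl
  ∑-cong-< (suc m) f≈g =
    +-cong (∑-cong-< m (λ i i<m → f≈g i (ℕₚ.m<n⇒m<1+n i<m))) (f≈g m ℕₚ.≤-refl)

  ∑-cong : ∀ m {f g : ℕ → Carrier} → (∀ i → f i ≈ g i) → ∑ m f ≈ ∑ m g
  ∑-cong m f≈g = ∑-cong-< m (λ i _ → f≈g i)

  ∑-≈0 : ∀ m {f : ℕ → Carrier} → (∀ i → i < m → f i ≈ 0#) → ∑ m f ≈ 0#
  ∑-≈0 zero    f≈0 = refl
  ∑-≈0 (suc m) f≈0 = trans
    (+-cong (∑-≈0 m (λ i i<m → f≈0 i (ℕₚ.m<n⇒m<1+n i<m))) (f≈0 m ℕₚ.≤-refl))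
    (+-identityˡ 0#)

  ∑-distrib-+ : ∀ m (f g : ℕ → Carrier) → ∑ m (λ i → f i + g i) ≈ ∑ m f + ∑ m g
  ∑-distrib-+ zero    f g = sym (+-identityˡ 0#)
  ∑-distrib-+ (suc m) f g = trans (+-cong (∑-distrib-+ m f g) refl) (interchange _ _ _ _)

  *-distribˡ-∑ : ∀ m a (f : ℕ → Carrier) → a * ∑ m f ≈ ∑ m (λ i → a * f i)
  *-distribˡ-∑ zero    a f = zeroʳ a
  *-distribˡ-∑ (suc m) a f = trans (distribˡ a _ _) (+-cong (*-distribˡ-∑ m a f) refl)

  ∑-head : ∀ m (f : ℕ → Carrier) → ∑ (suc m) f ≈ f 0 + ∑ m (λ i → f (suc i))
  ∑-head zero    f = trans (+-identityˡ _) (sym (+-identityʳ _))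
  ∑-head (suc m) f = trans (+-cong (∑-head m f) refl) (+-assoc _ _ _)

  ∑-reverse : ∀ n (f : ℕ → Carrier) → ∑ (suc n) f ≈ ∑ (suc n) (λ i → f (n ∸ i))
  ∑-reverse zero    f = refl
  ∑-reverse (suc n) f = begin
    ∑ (suc n) f + f (suc n)                   ≈⟨ +-cong (∑-reverse n f) refl ⟩
    ∑ (suc n) (λ i → f (n ∸ i)) + f (suc n)   ≈⟨ +-comm _ _ ⟩
    f (suc n) + ∑ (suc n) (λ i → f (n ∸ i))   ≈⟨ ∑-head (suc n) (λ i → f (suc n ∸ i)) ⟨
    ∑ (suc (suc n)) (λ i → f (suc n ∸ i))     ∎

  ∑-split : ∀ a b (f : ℕ → Carrier) → ∑ (a ℕ.+ b) f ≈ ∑ a f + ∑ b (λ i → f (a ℕ.+ i))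
  ∑-split a zero    f rewrite ℕₚ.+-identityʳ a = sym (+-identityʳ _)
  ∑-split a (suc b) f rewrite ℕₚ.+-suc a b =
    trans (+-cong (∑-split a b f) refl) (+-assoc _ _ _)

  infix 4 _≋_
  infixl 6 _+ₛ_
  infixr 7 _⋆_
  infix 25 -ₛ_

  _≋_ : Series → Series → Set ℓ
  f ≋ g = ∀ n → f n ≈ g n

  _+ₛ_ : Series → Series → Series
  (f +ₛ g) n = f n + g n

  -ₛ_ : Series → Series
  (-ₛ f) n = - f n

  0ₛ : Series
  0ₛ _ = 0#

  _⋆_ : Carrier → Series → Series
  (a ⋆ f) n = a * f n

  shift : Series → Series
  shift f n = f (suc n)

  ·ₛ-cong : ∀ {f f′ g g′} → f ≋ f′ → g ≋ g′ → f ·ₛ g ≋ f′ ·ₛ g′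
  ·ₛ-cong f≋f′ g≋g′ n = ∑-cong (suc n) (λ i → *-cong (f≋f′ i) (g≋g′ (n ∸ i)))

  ·ₛ-congˡ : ∀ h {f g} → f ≋ g → h ·ₛ f ≋ h ·ₛ g
  ·ₛ-congˡ h = ·ₛ-cong {h} {h} (λ _ → refl)

  ·ₛ-congʳ : ∀ h {f g} → f ≋ g → f ·ₛ h ≋ g ·ₛ h
  ·ₛ-congʳ h f≋g = ·ₛ-cong {g = h} {g′ = h} f≋g (λ _ → refl)

  ·ₛ-coeff-zero : ∀ f g → (f ·ₛ g) 0 ≈ f 0 * g 0
  ·ₛ-coeff-zero f g = +-identityˡ _

  ·ₛ-coeff-suc : ∀ f g n → (f ·ₛ g) (suc n) ≈ f 0 * g (suc n) + (shift f ·ₛ g) n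
  ·ₛ-coeff-suc f g n = ∑-head (suc n) (λ i → f i * g (suc n ∸ i))

  ·ₛ-distribʳ : ∀ h f g → (f +ₛ g) ·ₛ h ≋ f ·ₛ h +ₛ g ·ₛ h
  ·ₛ-distribʳ h f g n = trans
    (∑-cong (suc n) (λ i → distribʳ (h (n ∸ i)) (f i) (g i)))
    (∑-distrib-+ (suc n) _ _)

  ⋆-·ₛ : ∀ a f g → (a ⋆ f) ·ₛ g ≋ a ⋆ (f ·ₛ g)
  ⋆-·ₛ a f g n = trans
    (∑-cong (suc n) (λ i → *-assoc a (f i) (g (n ∸ i))))
    (sym (*-distribˡ-∑ (suc n) a _))

  ·ₛ-assoc : ∀ f g h → (f ·ₛ g) ·ₛ h ≋ f ·ₛ (g ·ₛ h)
  ·ₛ-assoc f g h zero = begin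
    ((f ·ₛ g) ·ₛ h) 0   ≈⟨ trans (·ₛ-coeff-zero (f ·ₛ g) h) (*-cong (·ₛ-coeff-zero f g) refl) ⟩
    (f 0 * g 0) * h 0   ≈⟨ *-assoc _ _ _ ⟩
    f 0 * (g 0 * h 0)   ≈⟨ trans (·ₛ-coeff-zero f (g ·ₛ h)) (*-cong refl (·ₛ-coeff-zero g h)) ⟨
    (f ·ₛ (g ·ₛ h)) 0   ∎
  ·ₛ-assoc f g h (suc n) = begin
    ((f ·ₛ g) ·ₛ h) (suc n)
      ≈⟨ ·ₛ-coeff-suc (f ·ₛ g) h n ⟩
    (f ·ₛ g) 0 * h (suc n) + (shift (f ·ₛ g) ·ₛ h) n
      ≈⟨ +-cong (*-cong (·ₛ-coeff-zero f g) refl) (·ₛ-congʳ h (·ₛ-coeff-suc f g) n) ⟩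
    (f 0 * g 0) * h (suc n) + ((f 0 ⋆ shift g +ₛ shift f ·ₛ g) ·ₛ h) n
      ≈⟨ +-cong refl (trans (·ₛ-distribʳ h (f 0 ⋆ shift g) (shift f ·ₛ g) n)
                            (+-cong (⋆-·ₛ (f 0) (shift g) h n) (·ₛ-assoc (shift f) g h n))) ⟩
    (f 0 * g 0) * h (suc n) + (f 0 * (shift g ·ₛ h) n + (shift f ·ₛ (g ·ₛ h)) n)
      ≈⟨ solve 5 (λ a b c d e → (a :* b) :* c :+ (a :* d :+ e) := a :* (b :* c :+ d) :+ e)
               refl (f 0) (g 0) (h (suc n)) ((shift g ·ₛ h) n) ((shift f ·ₛ (g ·ₛ h)) n) ⟩
    f 0 * (g 0 * h (suc n) + (shift g ·ₛ h) n) + (shift f ·ₛ (g ·ₛ h)) n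
      ≈⟨ +-cong (*-cong refl (·ₛ-coeff-suc g h n)) refl ⟨
    f 0 * (g ·ₛ h) (suc n) + (shift f ·ₛ (g ·ₛ h)) n
      ≈⟨ ·ₛ-coeff-suc f (g ·ₛ h) n ⟨
    (f ·ₛ (g ·ₛ h)) (suc n) ∎

  ·ₛ-comm : ∀ f g → f ·ₛ g ≋ g ·ₛ f
  ·ₛ-comm f g n = trans (∑-reverse n _) (∑-cong-< (suc n) λ i i<1+n →
    trans (*-comm _ _) (*-cong (reflexive (≡.cong g (ℕₚ.m∸[m∸n]≡n (ℕₚ.≤-pred i<1+n)))) refl))

  ·ₛ-identityˡ : ∀ f → oneₛ ·ₛ f ≋ f
  ·ₛ-identityˡ f n = begin
    (oneₛ ·ₛ f) n                               ≈⟨ ∑-head n _ ⟩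
    1# * f n + ∑ n (λ i → 0# * f (n ∸ suc i))   ≈⟨ +-cong (*-identityˡ _) (∑-≈0 n (λ _ _ → zeroˡ _)) ⟩
    f n + 0#                                    ≈⟨ +-identityʳ _ ⟩
    f n                                         ∎

  ·ₛ-identityʳ : ∀ f → f ·ₛ oneₛ ≋ f
  ·ₛ-identityʳ f n = trans (·ₛ-comm f oneₛ n) (·ₛ-identityˡ f n)

  ·ₛ-distribˡ : ∀ h f g → h ·ₛ (f +ₛ g) ≋ h ·ₛ f +ₛ h ·ₛ g
  ·ₛ-distribˡ h f g n = trans (·ₛ-comm h (f +ₛ g) n)
    (trans (·ₛ-distribʳ h f g n) (+-cong (·ₛ-comm f h n) (·ₛ-comm g h n)))

  seriesRing : CommutativeRing c ℓ
  seriesRing = record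
    { Carrier = Series ; _≈_ = _≋_ ; _+_ = _+ₛ_ ; _*_ = _·ₛ_ ; -_ = -ₛ_ ; 0# = 0ₛ ; 1# = oneₛ
    ; isCommutativeRing = record
      { isRing = record
        { +-isAbelianGroup = record
          { isGroup = record
            { isMonoid = record
              { isSemigroup = record
                { isMagma = record
                  { isEquivalence = record
                    { refl = λ _ → refl ; sym = λ p n → sym (p n) ; trans = λ p q n → trans (p n) (q n) }
                  ; ∙-cong = λ p q n → +-cong (p n) (q n) }
                ; assoc = λ f g h n → +-assoc (f n) (g n) (h n) }
              ; identity = (λ f n → +-identityˡ (f n)) , (λ f n → +-identityʳ (f n)) }
            ; inverse = (λ f n → -‿inverseˡ (f n)) , (λ f n → -‿inverseʳ (f n))
            ; ⁻¹-cong = λ p n → -‿cong (p n) }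
          ; comm = λ f g n → +-comm (f n) (g n) }
        ; *-cong = ·ₛ-cong
        ; *-assoc = ·ₛ-assoc
        ; *-identity = ·ₛ-identityˡ , ·ₛ-identityʳ
        ; distrib = ·ₛ-distribˡ , ·ₛ-distribʳ }
      ; *-comm = ·ₛ-comm }
    }

  module Series where
    private module R = CommutativeRing seriesRing
    open SemiringMult R.semiring public using (_×_)
    open SemiringSum R.semiring public using (sum; *-distribˡ-sum)
    open SemiringExp R.semiring public using (_^_)
    open Binomial R.commutativeSemiring public using (binomialExpansion)
      renaming (theorem to binomial-theorem)

  ×-coeff : ∀ m f n → (m Series.× f) n ≈ ι m * f n
  ×-coeff zero    f n = sym (zeroˡ _)
  ×-coeff (suc m) f n = trans (+-cong (sym (*-identityˡ _)) (×-coeff m f n)) (sym (distribʳ _ _ _))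

  sum-coeff : ∀ m (f : ℕ → Series) n → Series.sum {m} (λ i → f (toℕ i)) n ≈ ∑ m (λ i → f i n)
  sum-coeff zero    f n = refl
  sum-coeff (suc m) f n = trans (+-cong refl (sum-coeff m (λ i → f (suc i)) n)) (sym (∑-head m (λ i → f i n)))

  ^≋^ₛ : ∀ f k → f Series.^ k ≋ f ^ₛ k
  ^≋^ₛ f zero    = λ _ → refl
  ^≋^ₛ f (suc k) = ·ₛ-congˡ f (^≋^ₛ f k)

  ^ₛ-coeff-below : ∀ p → p 0 ≈ 0# → ∀ k m → m < k → (p ^ₛ k) m ≈ 0#
  ^ₛ-coeff-below p p₀≈0 (suc k) m (s≤s m≤k) = ∑-≈0 (suc m) vanish
    where
    vanish : ∀ i → i < suc m → p i * (p ^ₛ k) (m ∸ i) ≈ 0#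
    vanish zero    _               = trans (*-cong p₀≈0 refl) (zeroˡ _)
    vanish (suc i) (s≤s i<m) = trans
      (*-cong refl (^ₛ-coeff-below p p₀≈0 k (m ∸ suc i)
        (ℕₚ.<-≤-trans (ℕₚ.∸-monoʳ-< {o = 0} (s≤s z≤n) i<m) m≤k)))
      (zeroʳ _)

  t·ₛ-coeff-suc : ∀ p m → (tₛ ·ₛ p) (suc m) ≈ p m
  t·ₛ-coeff-suc p m = begin
    (tₛ ·ₛ p) (suc m)                      ≈⟨ ·ₛ-coeff-suc tₛ p m ⟩
    tₛ 0 * p (suc m) + (shift tₛ ·ₛ p) m   ≈⟨ +-cong (zeroˡ _) (·ₛ-congʳ p shift-t≋1 m) ⟩
    0# + (oneₛ ·ₛ p) m                     ≈⟨ trans (+-identityˡ _) (·ₛ-identityˡ p m) ⟩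
    p m                                    ∎
    where
    shift-t≋1 : shift tₛ ≋ oneₛ
    shift-t≋1 zero    = refl
    shift-t≋1 (suc _) = refl

  ·ₛ-[-t]^-coeff : ∀ j p m → (p ·ₛ ((-ₛ tₛ) ^ₛ j)) (j ℕ.+ m) ≈ pow (- 1#) j * p m
  ·ₛ-[-t]^-coeff zero    p m = trans (·ₛ-identityʳ p m) (sym (*-identityˡ _))
  ·ₛ-[-t]^-coeff (suc j) p m = begin
    (p ·ₛ (-ₛ tₛ ·ₛ ((-ₛ tₛ) ^ₛ j))) (suc (j ℕ.+ m))
      ≈⟨ ·ₛ-assoc p (-ₛ tₛ) ((-ₛ tₛ) ^ₛ j) _ ⟨
    ((p ·ₛ -ₛ tₛ) ·ₛ ((-ₛ tₛ) ^ₛ j)) (suc (j ℕ.+ m))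
      ≡⟨ ≡.cong ((p ·ₛ -ₛ tₛ) ·ₛ ((-ₛ tₛ) ^ₛ j)) (ℕₚ.+-suc j m) ⟨
    ((p ·ₛ -ₛ tₛ) ·ₛ ((-ₛ tₛ) ^ₛ j)) (j ℕ.+ suc m)
      ≈⟨ ·ₛ-[-t]^-coeff j (p ·ₛ -ₛ tₛ) (suc m) ⟩
    pow (- 1#) j * (p ·ₛ -ₛ tₛ) (suc m)
      ≈⟨ *-cong refl ·-t-coeff ⟩
    pow (- 1#) j * (- 1# * p m)
      ≈⟨ solve 3 (λ a b c → a :* (b :* c) := (b :* a) :* c) refl _ _ _ ⟩
    pow (- 1#) (suc j) * p m ∎
    where
    ·-t-coeff : (p ·ₛ -ₛ tₛ) (suc m) ≈ - 1# * p m
    ·-t-coeff = begin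
      (p ·ₛ -ₛ tₛ) (suc m)            ≈⟨ ·ₛ-comm p (-ₛ tₛ) (suc m) ⟩
      (-ₛ tₛ ·ₛ p) (suc m)            ≈⟨ ·ₛ-congʳ p (λ i → sym (-1*x≈-x (tₛ i))) (suc m) ⟩
      ((- 1# ⋆ tₛ) ·ₛ p) (suc m)      ≈⟨ ⋆-·ₛ (- 1#) tₛ p (suc m) ⟩
      - 1# * (tₛ ·ₛ p) (suc m)        ≈⟨ *-cong refl (t·ₛ-coeff-suc p m) ⟩
      - 1# * p m                      ∎

  module _ {b u : Series} (b·u≋t : b ·ₛ u ≋ tₛ) where

    private
      monomial term : ℕ → ℕ → Series
      monomial k i = (u Series.^ i) ·ₛ ((-ₛ tₛ) Series.^ (k ∸ i))
      term k i = (k C i) Series.× monomial k i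

    ·ₛ-binomial-coeff : ∀ k N → (b ·ₛ ((u +ₛ -ₛ tₛ) ^ₛ k)) N ≈ ∑ (suc k) (λ i → (b ·ₛ term k i) N)
    ·ₛ-binomial-coeff k N = begin
      (b ·ₛ ((u +ₛ -ₛ tₛ) ^ₛ k)) N
        ≈⟨ ·ₛ-congˡ b (λ m → trans (sym (^≋^ₛ (u +ₛ -ₛ tₛ) k m)) (Series.binomial-theorem k u (-ₛ tₛ) m)) N ⟩
      (b ·ₛ Series.binomialExpansion u (-ₛ tₛ) k) N
        ≈⟨ Series.*-distribˡ-sum {suc k} b (λ i → term k (toℕ i)) N ⟩
      Series.sum {suc k} (λ i → b ·ₛ term k (toℕ i)) N
        ≈⟨ sum-coeff (suc k) (λ i → b ·ₛ term k i) N ⟩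
      ∑ (suc k) (λ i → (b ·ₛ term k i) N) ∎

    ·ₛ-term-coeff : ∀ k n i → i ≤ k →
      (b ·ₛ term k i) (k ℕ.+ n) ≈ ι (k C i) * (pow (- 1#) (k ∸ i) * (b ·ₛ (u ^ₛ i)) (i ℕ.+ n))
    ·ₛ-term-coeff k n i i≤k = begin
      (b ·ₛ term k i) (k ℕ.+ n)
        ≈⟨ trans (·ₛ-comm b (term k i) _)
                 (trans (·ₛ-congʳ b (×-coeff (k C i) (monomial k i)) _) (⋆-·ₛ (ι (k C i)) (monomial k i) b _)) ⟩
      ι (k C i) * (monomial k i ·ₛ b) (k ℕ.+ n)
        ≈⟨ *-cong refl (trans (·ₛ-comm (monomial k i) b _) (trans (sym (·ₛ-assoc b (u Series.^ i) ((-ₛ tₛ) Series.^ (k ∸ i)) _))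
             (·ₛ-cong (·ₛ-congˡ b (^≋^ₛ u i)) (^≋^ₛ (-ₛ tₛ) (k ∸ i)) _))) ⟩
      ι (k C i) * ((b ·ₛ (u ^ₛ i)) ·ₛ ((-ₛ tₛ) ^ₛ (k ∸ i))) (k ℕ.+ n)
        ≡⟨ ≡.cong (λ N → ι (k C i) * ((b ·ₛ (u ^ₛ i)) ·ₛ ((-ₛ tₛ) ^ₛ (k ∸ i))) N) k+n≡[k∸i]+[i+n] ⟩
      ι (k C i) * ((b ·ₛ (u ^ₛ i)) ·ₛ ((-ₛ tₛ) ^ₛ (k ∸ i))) ((k ∸ i) ℕ.+ (i ℕ.+ n))
        ≈⟨ *-cong refl (·ₛ-[-t]^-coeff (k ∸ i) (b ·ₛ (u ^ₛ i)) (i ℕ.+ n)) ⟩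
      ι (k C i) * (pow (- 1#) (k ∸ i) * (b ·ₛ (u ^ₛ i)) (i ℕ.+ n)) ∎
      where
      k+n≡[k∸i]+[i+n] : k ℕ.+ n ≡ (k ∸ i) ℕ.+ (i ℕ.+ n)
      k+n≡[k∸i]+[i+n] = ≡.trans (≡.cong (ℕ._+ n) (≡.sym (ℕₚ.m∸n+n≡m i≤k))) (ℕₚ.+-assoc (k ∸ i) i n)

    b·u^suc-coeff : ∀ j n → (b ·ₛ (u ^ₛ suc j)) (suc j ℕ.+ n) ≈ (u ^ₛ j) (j ℕ.+ n)
    b·u^suc-coeff j n = begin
      (b ·ₛ (u ·ₛ (u ^ₛ j))) (suc (j ℕ.+ n))   ≈⟨ ·ₛ-assoc b u (u ^ₛ j) _ ⟨
      ((b ·ₛ u) ·ₛ (u ^ₛ j)) (suc (j ℕ.+ n))   ≈⟨ ·ₛ-congʳ (u ^ₛ j) b·u≋t _ ⟩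
      (tₛ ·ₛ (u ^ₛ j)) (suc (j ℕ.+ n))         ≈⟨ t·ₛ-coeff-suc (u ^ₛ j) (j ℕ.+ n) ⟩
      (u ^ₛ j) (j ℕ.+ n)                     ∎

    ·ₛ-[u-t]^-coeff : ∀ k n → (b ·ₛ ((u +ₛ -ₛ tₛ) ^ₛ k)) (k ℕ.+ n) ≈
      pow (- 1#) k * b n
        + ∑ k (λ j → ι (k C suc j) * (pow (- 1#) (k ∸ suc j) * (u ^ₛ j) (j ℕ.+ n)))
    ·ₛ-[u-t]^-coeff k n = begin
      (b ·ₛ ((u +ₛ -ₛ tₛ) ^ₛ k)) (k ℕ.+ n)
        ≈⟨ trans (·ₛ-binomial-coeff k (k ℕ.+ n)) (∑-head k _) ⟩
      (b ·ₛ term k 0) (k ℕ.+ n) + ∑ k (λ j → (b ·ₛ term k (suc j)) (k ℕ.+ n))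
        ≈⟨ +-cong (trans (·ₛ-term-coeff k n 0 z≤n) first)
                  (∑-cong-< k (λ j j<k → trans (·ₛ-term-coeff k n (suc j) j<k)
                                               (*-cong refl (*-cong refl (b·u^suc-coeff j n))))) ⟩
      pow (- 1#) k * b n
        + ∑ k (λ j → ι (k C suc j) * (pow (- 1#) (k ∸ suc j) * (u ^ₛ j) (j ℕ.+ n))) ∎
      where
      first : ι (k C 0) * (pow (- 1#) k * (b ·ₛ oneₛ) n) ≈ pow (- 1#) k * b n
      first = trans (*-cong (+-identityʳ 1#) (*-cong refl (·ₛ-identityʳ b n))) (*-identityˡ _)

  _≉0 : Carrier → Set ℓ
  x ≉0 = ¬ (x ≈ 0#)

  *-inverseˡ : ∀ x → x ≉0 → (x ⁻¹) * x ≈ 1#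
  *-inverseˡ x x≉0 = trans (*-comm _ _) (inverseʳ x x≉0)

  inverse-unique : ∀ a x y → a * x ≈ 1# → a * y ≈ 1# → x ≈ y
  inverse-unique a x y ax≈1 ay≈1 = begin
    x             ≈⟨ *-identityʳ x ⟨
    x * 1#        ≈⟨ *-cong refl ay≈1 ⟨
    x * (a * y)   ≈⟨ solve 3 (λ x a y → x :* (a :* y) := (a :* x) :* y) refl x a y ⟩
    (a * x) * y   ≈⟨ *-cong ax≈1 refl ⟩
    1# * y        ≈⟨ *-identityˡ y ⟩
    y             ∎

  *-≉0 : ∀ {a b} → a ≉0 → b ≉0 → (a * b) ≉0
  *-≉0 {a} {b} a≉0 b≉0 ab≈0 = b≉0 (begin
    b                 ≈⟨ trans (*-cong (*-inverseˡ a a≉0) refl) (*-identityˡ b) ⟨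
    ((a ⁻¹) * a) * b  ≈⟨ *-assoc _ _ _ ⟩
    (a ⁻¹) * (a * b)  ≈⟨ *-cong refl ab≈0 ⟩
    (a ⁻¹) * 0#       ≈⟨ zeroʳ _ ⟩
    0#                ∎)

  ι≡×1 : ∀ m → ι m ≡ m × 1#
  ι≡×1 zero    = ≡.refl
  ι≡×1 (suc m) = ≡.cong (1# +_) (ι≡×1 m)

  ι-* : ∀ m n → ι (m ℕ.* n) ≈ ι m * ι n
  ι-* m n rewrite ι≡×1 (m ℕ.* n) | ι≡×1 m | ι≡×1 n = ×1-homo-* m n

  fact≡! : ∀ m → fact m ≡ m !
  fact≡! zero    = ≡.refl
  fact≡! (suc m) = ≡.cong (suc m ℕ.*_) (fact≡! m)

  ι-fact-≉0 : ∀ m → ι (fact m) ≉0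
  ι-fact-≉0 m with fact m | fact≡! m
  ... | suc q | _    = charZero q
  ... | zero  | 0≡m! = λ _ → ℕ.≢-nonZero⁻¹ (m !) {{m ℕₚ.!≢0}} (≡.sym 0≡m!)

  binom*fact*fact≈fact : ∀ {m j} → j ≤ m → binom m j * (ι (fact j) * ι (fact (m ∸ j))) ≈ ι (fact m)
  binom*fact*fact≈fact {m} {j} j≤m = begin
    binom m j * (ι (fact j) * ι (fact (m ∸ j)))   ≈⟨ sym (trans (ι-* (m C j) _) (*-cong refl (ι-* (fact j) (fact (m ∸ j))))) ⟩
    ι ((m C j) ℕ.* (fact j ℕ.* fact (m ∸ j)))     ≡⟨ ≡.cong ι product≡ ⟩
    ι (fact m)                                    ∎
    where
    product≡ : (m C j) ℕ.* (fact j ℕ.* fact (m ∸ j)) ≡ fact m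
    product≡ rewrite fact≡! j | fact≡! (m ∸ j) | fact≡! m = binom*fact*fact≡fact j≤m

  module _ (λ′ : Carrier) (β : ℕ → Carrier) (isBernoulli : IsDegBernoulli λ′ β) (n k : ℕ) where
    private
      b u v : Series
      b m = β m * (ι (fact m) ⁻¹)
      u = eλ-1 λ′
      v = eλ-1-t λ′

    S2tr-term : ∀ j → j ≤ n →
      S2tr λ′ (n ∸ j ℕ.+ k) k * binom (n ℕ.+ k) j * β j
        ≈ ι (fact (n ℕ.+ k)) * (ι (fact k) ⁻¹ * (b j * (v ^ₛ k) (n ℕ.+ k ∸ j)))
    S2tr-term j j≤n rewrite ≡.sym (ℕₚ.+-∸-comm k j≤n) = begin
      (ι (fact m) * (K * V)) * Bin * β j
        ≈⟨ *-cong refl b*fact≈β ⟨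
      (ι (fact m) * (K * V)) * Bin * (b j * J)
        ≈⟨ solve 6 (λ A K V Bin B J → (A :* (K :* V)) :* Bin :* (B :* J)
                                      := (Bin :* (J :* A)) :* (K :* (B :* V)))
                   refl (ι (fact m)) K V Bin (b j) J ⟩
      (Bin * (J * ι (fact m))) * (K * (b j * V))
        ≈⟨ *-cong (binom*fact*fact≈fact j≤n+k) refl ⟩
      ι (fact (n ℕ.+ k)) * (K * (b j * V)) ∎
      where
      m = n ℕ.+ k ∸ j
      K = ι (fact k) ⁻¹
      V = (v ^ₛ k) m
      Bin = binom (n ℕ.+ k) j
      J = ι (fact j)
      j≤n+k : j ≤ n ℕ.+ k
      j≤n+k = ℕₚ.≤-trans j≤n (ℕₚ.m≤m+n n k)
      b*fact≈β : b j * J ≈ β j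
      b*fact≈β = trans (*-assoc _ _ _) (trans (*-cong refl (*-inverseˡ J (ι-fact-≉0 j))) (*-identityʳ _))

    -- Only j ≤ n contributes, because v has no constant term.
    b·v^k-coeff : (b ·ₛ (v ^ₛ k)) (n ℕ.+ k) ≈ ∑ (suc n) (λ j → b j * (v ^ₛ k) (n ℕ.+ k ∸ j))
    b·v^k-coeff = begin
      ∑ (suc n ℕ.+ k) f                                ≈⟨ ∑-split (suc n) k f ⟩
      ∑ (suc n) f + ∑ k (λ i → f (suc n ℕ.+ i))        ≈⟨ +-cong refl (∑-≈0 k high-terms≈0) ⟩
      ∑ (suc n) f + 0#                                 ≈⟨ +-identityʳ _ ⟩
      ∑ (suc n) f                                      ∎
      where
      f : ℕ → Carrier
      f j = b j * (v ^ₛ k) (n ℕ.+ k ∸ j)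
      v₀≈0 : v 0 ≈ 0#
      v₀≈0 = -‿inverseʳ 0#
      high-terms≈0 : ∀ i → i < k → f (suc n ℕ.+ i) ≈ 0#
      high-terms≈0 i i<k = trans (*-cong refl (^ₛ-coeff-below v v₀≈0 k _ index<k)) (zeroʳ _)
        where
        index<k : n ℕ.+ k ∸ (suc n ℕ.+ i) < k
        index<k rewrite ≡.sym (ℕₚ.+-suc n i) | ℕₚ.[m+n]∸[m+o]≡n∸o n k (suc i) =
          ℕₚ.∸-monoʳ-< {o = 0} (s≤s z≤n) i<k

    lhs≈coeff : ∑ (suc n) (λ j → S2tr λ′ (n ∸ j ℕ.+ k) k * binom (n ℕ.+ k) j * β j)
      ≈ ι (fact (n ℕ.+ k)) * (ι (fact k) ⁻¹ * (b ·ₛ (v ^ₛ k)) (k ℕ.+ n))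
    lhs≈coeff = begin
      ∑ (suc n) (λ j → S2tr λ′ (n ∸ j ℕ.+ k) k * binom (n ℕ.+ k) j * β j)
        ≈⟨ ∑-cong-< (suc n) (λ j j<1+n → S2tr-term j (ℕₚ.≤-pred j<1+n)) ⟩
      ∑ (suc n) (λ j → ι (fact (n ℕ.+ k)) * (ι (fact k) ⁻¹ * (b j * (v ^ₛ k) (n ℕ.+ k ∸ j))))
        ≈⟨ trans (*-cong refl (*-distribˡ-∑ (suc n) _ _)) (*-distribˡ-∑ (suc n) _ _) ⟨
      ι (fact (n ℕ.+ k)) * (ι (fact k) ⁻¹ * ∑ (suc n) (λ j → b j * (v ^ₛ k) (n ℕ.+ k ∸ j)))
        ≈⟨ *-cong refl (*-cong refl b·v^k-coeff) ⟨
      ι (fact (n ℕ.+ k)) * (ι (fact k) ⁻¹ * (b ·ₛ (v ^ₛ k)) (n ℕ.+ k))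
        ≡⟨ ≡.cong (λ m → ι (fact (n ℕ.+ k)) * (ι (fact k) ⁻¹ * (b ·ₛ (v ^ₛ k)) m)) (ℕₚ.+-comm n k) ⟩
      ι (fact (n ℕ.+ k)) * (ι (fact k) ⁻¹ * (b ·ₛ (v ^ₛ k)) (k ℕ.+ n)) ∎

    leading-term : ι (fact (n ℕ.+ k)) * (ι (fact k) ⁻¹ * (pow (- 1#) k * b n))
      ≈ pow (- 1#) k * binom (n ℕ.+ k) k * β n
    leading-term = begin
      Fn * (K⁻¹ * (P * (β n * N⁻¹)))
        ≈⟨ *-cong (binom*fact*fact≈fact (ℕₚ.m≤n+m k n)) refl ⟨
      (Bin * (K * ι (fact (n ℕ.+ k ∸ k)))) * (K⁻¹ * (P * (β n * N⁻¹)))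
        ≡⟨ ≡.cong (λ m → (Bin * (K * ι (fact m))) * (K⁻¹ * (P * (β n * N⁻¹)))) (ℕₚ.m+n∸n≡m n k) ⟩
      (Bin * (K * N)) * (K⁻¹ * (P * (β n * N⁻¹)))
        ≈⟨ solve 7 (λ Bin K N K⁻¹ P B N⁻¹ → (Bin :* (K :* N)) :* (K⁻¹ :* (P :* (B :* N⁻¹)))
                     := (P :* Bin :* B) :* ((K :* K⁻¹) :* (N :* N⁻¹)))
                   refl Bin K N K⁻¹ P (β n) N⁻¹ ⟩
      (P * Bin * β n) * ((K * K⁻¹) * (N * N⁻¹))
        ≈⟨ *-cong refl (*-cong (inverseʳ K (ι-fact-≉0 k)) (inverseʳ N (ι-fact-≉0 n))) ⟩
      (P * Bin * β n) * (1# * 1#)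
        ≈⟨ trans (*-cong refl (*-identityˡ 1#)) (*-identityʳ _) ⟩
      P * Bin * β n ∎
      where
      Fn = ι (fact (n ℕ.+ k))
      K = ι (fact k)
      K⁻¹ = K ⁻¹
      N = ι (fact n)
      N⁻¹ = N ⁻¹
      P = pow (- 1#) k
      Bin = binom (n ℕ.+ k) k

    S2-term : ∀ i → i < k →
      ι (fact k) ⁻¹ * (ι (k C suc i) * (pow (- 1#) (k ∸ suc i) * (u ^ₛ i) (i ℕ.+ n)))
        ≈ pow (- 1#) (k ∸ suc i)
          * ((ι (suc i) * ι (fact (k ∸ suc i)) * ι (fact (n ℕ.+ i))) ⁻¹)
          * S2 λ′ (n ℕ.+ i) i
    S2-term i i<k = begin
      K⁻¹ * (Bin * (Q * U))
        ≈⟨ *-assoc _ _ _ ⟨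
      (K⁻¹ * Bin) * (Q * U)
        ≈⟨ *-cong K⁻¹*Bin≈D⁻¹*N*I⁻¹ refl ⟩
      (D ⁻¹ * N * I ⁻¹) * (Q * U)
        ≈⟨ solve 5 (λ D⁻¹ N I⁻¹ Q U → (D⁻¹ :* N :* I⁻¹) :* (Q :* U) := Q :* D⁻¹ :* (N :* (I⁻¹ :* U)))
                   refl (D ⁻¹) N (I ⁻¹) Q U ⟩
      Q * D ⁻¹ * (N * (I ⁻¹ * U))
        ≡⟨ ≡.cong (λ m → Q * D ⁻¹ * (N * (I ⁻¹ * (u ^ₛ i) m))) (ℕₚ.+-comm i n) ⟩
      Q * D ⁻¹ * S2 λ′ (n ℕ.+ i) i ∎
      where
      K⁻¹ = ι (fact k) ⁻¹
      Bin = ι (k C suc i)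
      Q = pow (- 1#) (k ∸ suc i)
      U = (u ^ₛ i) (i ℕ.+ n)
      S = ι (suc i)
      R = ι (fact (k ∸ suc i))
      N = ι (fact (n ℕ.+ i))
      I = ι (fact i)
      D = S * R * N

      -- Both sides are inverses of (i+1)! (k-i-1)! = S I R.
      K⁻¹*Bin≈D⁻¹*N*I⁻¹ : K⁻¹ * Bin ≈ D ⁻¹ * N * I ⁻¹
      K⁻¹*Bin≈D⁻¹*N*I⁻¹ = inverse-unique (S * I * R) _ _ left-inverse right-inverse
        where
        left-inverse : (S * I * R) * (K⁻¹ * Bin) ≈ 1#
        left-inverse = begin
          (S * I * R) * (K⁻¹ * Bin)
            ≈⟨ solve 5 (λ S I R K⁻¹ Bin → (S :* I :* R) :* (K⁻¹ :* Bin) := (Bin :* ((S :* I) :* R)) :* K⁻¹)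
                       refl S I R K⁻¹ Bin ⟩
          (Bin * ((S * I) * R)) * K⁻¹
            ≈⟨ *-cong (*-cong refl (*-cong (ι-* (suc i) (fact i)) refl)) refl ⟨
          (Bin * (ι (fact (suc i)) * R)) * K⁻¹
            ≈⟨ *-cong (binom*fact*fact≈fact i<k) refl ⟩
          ι (fact k) * K⁻¹
            ≈⟨ inverseʳ _ (ι-fact-≉0 k) ⟩
          1# ∎

        D≉0 : D ≉0
        D≉0 = *-≉0 (*-≉0 (charZero i) (ι-fact-≉0 (k ∸ suc i))) (ι-fact-≉0 (n ℕ.+ i))

        right-inverse : (S * I * R) * (D ⁻¹ * N * I ⁻¹) ≈ 1#
        right-inverse = begin
          (S * I * R) * (D ⁻¹ * N * I ⁻¹)
            ≈⟨ solve 6 (λ S I R N D⁻¹ I⁻¹ → (S :* I :* R) :* (D⁻¹ :* N :* I⁻¹)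
                                            := ((S :* R :* N) :* D⁻¹) :* (I :* I⁻¹))
                       refl S I R N (D ⁻¹) (I ⁻¹) ⟩
          (D * D ⁻¹) * (I * I ⁻¹)
            ≈⟨ *-cong (inverseʳ D D≉0) (inverseʳ I (ι-fact-≉0 i)) ⟩
          1# * 1#
            ≈⟨ *-identityˡ 1# ⟩
          1# ∎

    S2tr-β-identity : ∑ (suc n) (λ j → S2tr λ′ (n ∸ j ℕ.+ k) k * binom (n ℕ.+ k) j * β j)
      ≈ pow (- 1#) k * binom (n ℕ.+ k) k * β n
        + ι (fact (n ℕ.+ k)) * ∑ k (λ i →
            pow (- 1#) (k ∸ suc i)
            * ((ι (suc i) * ι (fact (k ∸ suc i)) * ι (fact (n ℕ.+ i))) ⁻¹)
            * S2 λ′ (n ℕ.+ i) i)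
    S2tr-β-identity = begin
      ∑ (suc n) (λ j → S2tr λ′ (n ∸ j ℕ.+ k) k * binom (n ℕ.+ k) j * β j)
        ≈⟨ lhs≈coeff ⟩
      Fn * (K⁻¹ * (b ·ₛ (v ^ₛ k)) (k ℕ.+ n))
        ≈⟨ *-cong refl (*-cong refl (·ₛ-[u-t]^-coeff isBernoulli k n)) ⟩
      Fn * (K⁻¹ * (pow (- 1#) k * b n + ∑ k S2-summand))
        ≈⟨ trans (*-cong refl (distribˡ _ _ _)) (distribˡ _ _ _) ⟩
      Fn * (K⁻¹ * (pow (- 1#) k * b n)) + Fn * (K⁻¹ * ∑ k S2-summand)
        ≈⟨ +-cong leading-term (*-cong refl (trans (*-distribˡ-∑ k K⁻¹ S2-summand) (∑-cong-< k S2-term))) ⟩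
      pow (- 1#) k * binom (n ℕ.+ k) k * β n
        + Fn * ∑ k (λ i →
            pow (- 1#) (k ∸ suc i)
            * ((ι (suc i) * ι (fact (k ∸ suc i)) * ι (fact (n ℕ.+ i))) ⁻¹)
            * S2 λ′ (n ℕ.+ i) i) ∎
      where
      Fn = ι (fact (n ℕ.+ k))
      K⁻¹ = ι (fact k) ⁻¹
      S2-summand : ℕ → Carrier
      S2-summand j = ι (k C suc j) * (pow (- 1#) (k ∸ suc j) * (u ^ₛ j) (j ℕ.+ n))

theorem5 : ∀ {c ℓ : Level} (F : Char0Field c ℓ) →
    let open WithField F in
    (λ′ : Carrier) → ¬ (λ′ ≈ 0#) →
    (β : ℕ → Carrier) → IsDegBernoulli λ′ β →
    (n k : ℕ) →
    ∑ (suc n) (λ j → S2tr λ′ (n ℕ.∸ j ℕ.+ k) k * binom (n ℕ.+ k) j * β j)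
      ≈ pow (- 1#) k * binom (n ℕ.+ k) k * β n
        + ι (fact (n ℕ.+ k)) * ∑ k (λ i →
            pow (- 1#) (k ℕ.∸ suc i)
            * ((ι (suc i) * ι (fact (k ℕ.∸ suc i)) * ι (fact (n ℕ.+ i))) ⁻¹)
            * S2 λ′ (n ℕ.+ i) i)
theorem5 F λ′ _ β isBernoulli n k = S2tr-β-identity F λ′ β isBernoulli n k
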